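{- For every QBF $\Phi=\Pi.\phi$, the following algorithm terminates. Algorithm: with $U$ the universal and $E$ the existential variables of $\Pi$, set $A_0:=\{\alpha_0\}$ for an arbitrary full assignment $\alpha_0\colon U\to\{\top,\bot\}$, $S_0:=\emptyset$, $i:=1$. Repeat: (a) check satisfiability of $\bigwedge_{\alpha\in A_{i-1}}\phi^\alpha$; if unsatisfiable return false, otherwise let $\tau$ be a satisfying assignment (assigning all annotated variables $x^\alpha$, $x\in E$, $\alpha\in A_{i-1}$) and set $S_i:=S_{i-1}\cup\{(\tau|_{E^\alpha})^{ -\alpha}\mid \alpha\in A_{i-1}\}$; (b) check satisfiability of $\bigwedge_{\sigma\in S_i}\lnot\phi^\sigma$; if unsatisfiable return true, otherwise let $\rho$ be a satisfying assignment (assigning all $x^\sigma$, $x\in U$, $\sigma\in S_i$) and set $A_i:=A_{i-1}\cup\{(\rho|_{U^\sigma})^{ -\sigma}\mid\sigma\in S_i\}$; (c) increment $i$.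
   Context: A QBF is $\Pi.\phi$ where $\Pi=Q_1x_1\ldots Q_nx_n$ with $Q_i\in\{\forall,\exists\}$ and pairwise distinct variables, $X=\{x_1,\dots,x_n\}$, $\phi$ a propositional formula over $X$; $U$ ($E$) is the set of universally (existentially) quantified variables, and $x_i<_\Pi x_j$ iff $i<j$. An assignment for $Y$ is $\sigma\colon Y\to\{\top,\bot,\epsilon\}$ ($\epsilon$ = unassigned), full if it never takes value $\epsilon$; $\sigma|_Z$ is its restriction to $Z$. Instantiation: for an assignment $\sigma$ on a subset of $X$ (extended by $\epsilon$), $\phi^\sigma$ is obtained from $\phi$ by replacing every $x$ with $\sigma(x)\neq\epsilon$ by $\sigma(x)$ (with propositional simplification), and every $x$ with $\sigma(x)=\epsilon$ by the annotated variable $x^\omega$, where $\omega=\sigma(x_{k_1})\cdots\sigma(x_{k_m})$ for $x_{k_1}<_\Pi\cdots<_\Pi x_{k_m}$ all variables preceding $x$, each $\epsilon$ contributing the empty word (empty annotation identifies $x^\omega$ with $x$). Annotated variables with the same name and annotation are the same variable. Write $x^\sigma$ for the variable replacing $x$ in $\phi^\sigma$, $E^\sigma=\{x^\sigma: x\in E,\sigma(x)=\epsilon\}$, $U^\sigma=\{x^\sigma:x\in U,\sigma(x)=\epsilon\}$. For an assignment $\tau$ to annotated variables, $\tau^{ -\sigma}$ is the assignment $x\mapsto\tau(x^\sigma)$. -}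

module Defs where

open import Data.Bool using (Bool; true; false; if_then_else_; _∧_; _∨_; not)
open import Data.Nat using (ℕ; _<ᵇ_)
open import Data.Fin using (Fin; toℕ)
open import Data.List using (List; []; _∷_; _++_; map; concatMap; allFin)
open import Data.List.Relation.Unary.All using (All)
open import Data.Maybe using (Maybe; just; nothing; maybe; is-nothing)
open import Data.Product using (Σ; _×_; _,_)
open import Relation.Binary.PropositionalEquality using (_≡_)

data Quant : Set where
  ∀q ∃q : Quant

_=Q_ : Quant → Quant → Bool
∀q =Q ∀q = true
∃q =Q ∃q = true
_  =Q _  = false

data Form (V : Set) : Set where
  var : V → Form V
  top : Form V
  bot : Form V
  neg : Form V → Form V
  and : Form V → Form V → Form V
  or  : Form V → Form V → Form V
  imp : Form V → Form V → Form V

eval : {V : Set} → (V → Bool) → Form V → Bool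
eval τ (var x)   = τ x
eval τ top       = true
eval τ bot       = false
eval τ (neg p)   = not (eval τ p)
eval τ (and p q) = eval τ p ∧ eval τ q
eval τ (or p q)  = eval τ p ∨ eval τ q
eval τ (imp p q) = not (eval τ p) ∨ eval τ q

-- A QBF Π.φ over variables x_1..x_n (represented by Fin n, with the
-- prefix order <_Π being the index order) is given by a prefix
-- Q : Fin n → Quant and a matrix φ : Form (Fin n).

-- Assignments σ : X → {⊤,⊥,ε}; nothing = ε.
Assign : ℕ → Set
Assign n = Fin n → Maybe Bool

-- Annotated variables x^ω : a variable name together with an annotation word.
AnnVar : ℕ → Set
AnnVar n = Fin n × List Bool

word : {n : ℕ} → Assign n → Fin n → List Bool
word {n} σ x =
  concatMap (λ y → if toℕ y <ᵇ toℕ x then maybe (λ b → b ∷ []) [] (σ y) else [])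
            (allFin n)

annot : {n : ℕ} → Assign n → Fin n → AnnVar n
annot σ x = x , word σ x

-- Instantiation φ^σ (assigned variables replaced by constants, unassigned
-- ones by their annotated versions; propositional simplification is omitted
-- since it preserves the semantics).
inst : {n : ℕ} → Assign n → Form (Fin n) → Form (AnnVar n)
inst σ (var x) with σ x
... | just true  = top
... | just false = bot
... | nothing    = var (annot σ x)
inst σ top       = top
inst σ bot       = bot
inst σ (neg p)   = neg (inst σ p)
inst σ (and p q) = and (inst σ p) (inst σ q)
inst σ (or p q)  = or (inst σ p) (inst σ q)
inst σ (imp p q) = imp (inst σ p) (inst σ q)

-- (τ|_{Q^σ})^{-σ} for Q ∈ {U, E} selected by q:
-- x ↦ τ(x^σ) if x is q-quantified and σ(x) = ε, and ε otherwise.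
unann : {n : ℕ} → (Fin n → Quant) → Quant → (AnnVar n → Bool) → Assign n → Assign n
unann Q q τ σ x =
  if (q =Q Q x) ∧ is-nothing (σ x) then just (τ (annot σ x)) else nothing

-- State of the loop at the start of iteration i: (A_{i-1}, S_{i-1}).
State : ℕ → Set
State n = List (Assign n) × List (Assign n)

initState : {n : ℕ} → (Fin n → Quant) → (Fin n → Bool) → State n
initState Q f =
  ((λ x → if ∀q =Q Q x then just (f x) else nothing) ∷ []) , []

nextS : {n : ℕ} → (Fin n → Quant) → (AnnVar n → Bool) → State n → List (Assign n)
nextS Q τ (A , S) = S ++ map (unann Q ∃q τ) A

-- One full (non-returning) iteration of the loop: (A_{i-1},S_{i-1}) ↦ (A_i,S_i).
-- τ satisfies ⋀_{α∈A_{i-1}} φ^α, and ρ satisfies ⋀_{σ∈S_i} ¬φ^σ, where the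
-- choices of τ and ρ are arbitrary (nondeterministic).  If one of the
-- satisfiability checks fails, the algorithm returns, i.e. there is no
-- successor state.
Step : {n : ℕ} → (Fin n → Quant) → Form (Fin n) → State n → State n → Set
Step Q φ (A , S) (A' , S') =
  Σ (AnnVar _ → Bool) λ τ →
    All (λ α → eval τ (inst α φ) ≡ true) A ×
    S' ≡ nextS Q τ (A , S) ×
    Σ (AnnVar _ → Bool) λ ρ →
      All (λ σ → eval ρ (neg (inst σ φ)) ≡ true) S' ×
      A' ≡ A ++ map (unann Q ∀q ρ) S'

{-# OPTIONS --safe #-}
module Submission where

-- Let counter α be the universal assignment that a round extracts from ρ on the
-- response of τ to α, and call A closed when the universal part of every counter α
-- (α ∈ A) already occurs in A. A round is impossible on a closed A: if α ∈ A agrees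
-- with counter α on the first k variables and β ∈ A equals counter α, then β agrees
-- with counter β on the first k + 1 variables, since the value of counter at a variable
-- depends only on the values preceding it. At k = n this yields α = counter α, so φ^α
-- under τ and φ^(response α) under ρ both evaluate φ under the same valuation, although
-- τ satisfies the first and ρ falsifies the second. Hence every round covers a new full
-- assignment of U, and there are only finitely many of those.

open import Defs
open import Data.Bool using (Bool; true; false; if_then_else_; _∧_; _∨_; not)
open import Data.Bool.Properties using (_≟_; not-injective; T-≡)
open import Data.Fin as Fin using (Fin; toℕ)
open import Data.Fin.Properties using (all?; toℕ<n)
open import Data.List using (List; []; _∷_; _++_; allFin; map; filter; length; cartesianProductWith)
open import Data.List.Membership.Propositional using (_∈_; find; lose)
open import Data.List.Membership.Propositional.Properties using (∈-map⁺; ∈-++⁺ˡ; ∈-++⁺ʳ)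
open import Data.List.Properties using (filter-accept; filter-reject; concatMap-cong)
open import Data.List.Relation.Binary.Sublist.Heterogeneous.Properties using (length-mono-≤; ⊆-filter-Sublist)
open import Data.List.Relation.Binary.Sublist.Propositional using (⊆-refl)
open import Data.List.Relation.Unary.All as All using (All; []; _∷_)
import Data.List.Relation.Unary.All.Properties as Allₚ
open import Data.List.Relation.Unary.Any as Any using (Any; here; there; any?)
import Data.List.Relation.Unary.Any.Properties as Anyₚ
open import Data.Maybe using (just; nothing; maybe; fromMaybe; is-nothing)
open import Data.Maybe.Properties using (≡-dec)
open import Data.Nat using (ℕ; zero; suc; _<_; _≤_; _<ᵇ_; s≤s)
open import Data.Nat.Induction using (<-wellFounded)
open import Data.Nat.Properties using (<ᵇ⇒<; <-≤-trans; <⇒≤; m<1+n⇒m≤n; m<n⇒m<1+n)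
open import Data.Product using (∃-syntax; _×_; _,_)
open import Data.Sum using (_⊎_; inj₁; inj₂)
open import Data.Vec.Functional as Vector using ()
open import Function using (_∘_; Equivalence)
open import Induction.WellFounded using (Acc; acc)
open import Relation.Nullary using (¬_; Dec; yes; no; contradiction; ¬?; _→-dec_)
open import Relation.Unary using (Decidable)
open import Relation.Binary.PropositionalEquality
  using (_≡_; _≗_; refl; sym; trans; cong; cong₂; module ≡-Reasoning)

module _ {A : Set} {P Q : A → Set} (P? : Decidable P) (Q? : Decidable Q)
         (P⇒Q : ∀ {x} → P x → Q x) where

  length-filter-mono : ∀ xs → length (filter P? xs) ≤ length (filter Q? xs)
  length-filter-mono xs = length-mono-≤ (⊆-filter-Sublist P? Q? (λ { refl → P⇒Q }) (⊆-refl {x = xs}))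

  length-filter-< : ∀ {xs} → Any (λ x → Q x × ¬ P x) xs →
                    length (filter P? xs) < length (filter Q? xs)
  length-filter-< {x ∷ xs} (here (qx , ¬px))
    rewrite filter-reject P? {xs = xs} ¬px | filter-accept Q? {xs = xs} qx = s≤s (length-filter-mono xs)
  length-filter-< {x ∷ xs} (there any) with P? x | Q? x
  ... | yes px | no ¬qx = contradiction (P⇒Q px) ¬qx
  ... | yes _  | yes _  = s≤s (length-filter-< any)
  ... | no _   | yes _  = m<n⇒m<1+n (length-filter-< any)
  ... | no _   | no _   = length-filter-< any

valuations : ∀ n → List (Fin n → Bool)
valuations zero    = Vector.[] ∷ []
valuations (suc n) = cartesianProductWith Vector._∷_ (true ∷ false ∷ []) (valuations n)

valuations-complete : ∀ {n} (g : Fin n → Bool) → Any (_≗ g) (valuations n)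
valuations-complete {zero}  g = here λ ()
valuations-complete {suc n} g =
  Anyₚ.cartesianProductWith⁺ Vector._∷_ cons-≗
    (bool-listed (g Fin.zero)) (valuations-complete (g ∘ Fin.suc))
  where
  bool-listed : ∀ b → Any (_≡ b) (true ∷ false ∷ [])
  bool-listed true  = here refl
  bool-listed false = there (here refl)
  cons-≗ : ∀ {b h} → b ≡ g Fin.zero → h ≗ g ∘ Fin.suc → (b Vector.∷ h) ≗ g
  cons-≗ b≡ h≗ Fin.zero    = b≡
  cons-≗ b≡ h≗ (Fin.suc y) = h≗ y

eval-cong : {V : Set} {v w : V → Bool} → v ≗ w → ∀ ψ → eval v ψ ≡ eval w ψ
eval-cong v≗w (var x)   = v≗w x
eval-cong v≗w top       = refl
eval-cong v≗w bot       = refl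
eval-cong v≗w (neg p)   = cong not (eval-cong v≗w p)
eval-cong v≗w (and p q) = cong₂ _∧_ (eval-cong v≗w p) (eval-cong v≗w q)
eval-cong v≗w (or p q)  = cong₂ _∨_ (eval-cong v≗w p) (eval-cong v≗w q)
eval-cong v≗w (imp p q) = cong₂ (_∨_ ∘ not) (eval-cong v≗w p) (eval-cong v≗w q)

module _ {n : ℕ} where

  fill : (AnnVar n → Bool) → Assign n → Fin n → Bool
  fill τ σ x = fromMaybe (τ (annot σ x)) (σ x)

  eval-inst : (τ : AnnVar n → Bool) (σ : Assign n) (ψ : Form (Fin n)) →
              eval τ (inst σ ψ) ≡ eval (fill τ σ) ψ
  eval-inst τ σ (var x) with σ x
  ... | just true  = refl
  ... | just false = refl
  ... | nothing    = refl
  eval-inst τ σ top       = refl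
  eval-inst τ σ bot       = refl
  eval-inst τ σ (neg p)   = cong not (eval-inst τ σ p)
  eval-inst τ σ (and p q) = cong₂ _∧_ (eval-inst τ σ p) (eval-inst τ σ q)
  eval-inst τ σ (or p q)  = cong₂ _∨_ (eval-inst τ σ p) (eval-inst τ σ q)
  eval-inst τ σ (imp p q) = cong₂ (_∨_ ∘ not) (eval-inst τ σ p) (eval-inst τ σ q)

  AgreeBelow : ℕ → Assign n → Assign n → Set
  AgreeBelow k σ σ′ = ∀ y → toℕ y < k → σ y ≡ σ′ y

  AgreeBelow-mono : ∀ {j k σ σ′} → j ≤ k → AgreeBelow k σ σ′ → AgreeBelow j σ σ′
  AgreeBelow-mono j≤k agree y y<j = agree y (<-≤-trans y<j j≤k)

  word-cong : ∀ {σ σ′} x → AgreeBelow (toℕ x) σ σ′ → word σ x ≡ word σ′ x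
  word-cong {σ} {σ′} x agree = concatMap-cong letter-cong (allFin n)
    where
    letter : Assign n → Fin n → List Bool
    letter ς y = if toℕ y <ᵇ toℕ x then maybe (λ b → b ∷ []) [] (ς y) else []
    letter-cong : letter σ ≗ letter σ′
    letter-cong y with toℕ y <ᵇ toℕ x in y<x
    ... | true  = cong (maybe (λ b → b ∷ []) []) (agree y (<ᵇ⇒< _ _ (Equivalence.from T-≡ y<x)))
    ... | false = refl

module _ {n : ℕ} (Q : Fin n → Quant) where

  OnlyUniversal : Assign n → Set
  OnlyUniversal σ = ∀ x → Q x ≡ ∃q → σ x ≡ nothing

  ∀-or-∃ : ∀ x → Q x ≡ ∀q ⊎ Q x ≡ ∃q
  ∀-or-∃ x with Q x
  ... | ∀q = inj₁ refl
  ... | ∃q = inj₂ refl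

  unann-∃-at-∀ : ∀ {τ σ x} → Q x ≡ ∀q → unann Q ∃q τ σ x ≡ nothing
  unann-∃-at-∀ Qx≡∀ rewrite Qx≡∀ = refl

  unann-∀-at-∃ : ∀ {τ σ x} → Q x ≡ ∃q → unann Q ∀q τ σ x ≡ nothing
  unann-∀-at-∃ Qx≡∃ rewrite Qx≡∃ = refl

  unann-match : ∀ {q τ σ x} → Q x ≡ q → σ x ≡ nothing → unann Q q τ σ x ≡ just (τ (annot σ x))
  unann-match {∀q} Qx≡q σx≡ε rewrite Qx≡q | σx≡ε = refl
  unann-match {∃q} Qx≡q σx≡ε rewrite Qx≡q | σx≡ε = refl

  unann-cong : ∀ {q τ σ σ′} x → AgreeBelow (toℕ x) σ σ′ → σ x ≡ σ′ x →
               unann Q q τ σ x ≡ unann Q q τ σ′ x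
  unann-cong {q} {τ} x agree σx≡σ′x =
    cong₂ (λ v w → if (q =Q Q x) ∧ is-nothing v then just (τ (x , w)) else nothing)
          σx≡σ′x (word-cong x agree)

  unann-agree : ∀ {q τ k σ σ′} → AgreeBelow k σ σ′ →
                AgreeBelow k (unann Q q τ σ) (unann Q q τ σ′)
  unann-agree {q} {τ} {σ = σ} {σ′} agree y y<k =
    unann-cong {q} {τ} {σ} {σ′} y (AgreeBelow-mono (<⇒≤ y<k) agree) (agree y y<k)

  unann-∃-agree : ∀ {τ k σ σ′} → OnlyUniversal σ → OnlyUniversal σ′ →
                  AgreeBelow k σ σ′ → AgreeBelow (suc k) (unann Q ∃q τ σ) (unann Q ∃q τ σ′)
  unann-∃-agree {τ} {σ = σ} {σ′} univ univ′ agree y y≤k with ∀-or-∃ y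
  ... | inj₁ Qy = trans (unann-∃-at-∀ {τ} {σ} Qy) (sym (unann-∃-at-∀ {τ} {σ′} Qy))
  ... | inj₂ Qy = unann-cong {∃q} {τ} {σ} {σ′} y (AgreeBelow-mono (m<1+n⇒m≤n y≤k) agree)
                             (trans (univ y Qy) (sym (univ′ y Qy)))

  unann-∀-OnlyUniversal : ∀ {ρ σ} → OnlyUniversal (unann Q ∀q ρ σ)
  unann-∀-OnlyUniversal {ρ} {σ} x = unann-∀-at-∃ {ρ} {σ}

  Covers : Assign n → (Fin n → Bool) → Set
  Covers γ g = ∀ y → Q y ≡ ∀q → γ y ≡ just (g y)

  Covered : List (Assign n) → (Fin n → Bool) → Set
  Covered A g = Any (λ γ → Covers γ g) A

  covered? : ∀ A → Decidable (Covered A)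
  covered? A g = any? (λ γ → all? λ y → is-∀ (Q y) →-dec ≡-dec _≟_ (γ y) (just (g y))) A
    where
    is-∀ : ∀ q → Dec (q ≡ ∀q)
    is-∀ ∀q = yes refl
    is-∀ ∃q = no λ ()

  Covered-resp : ∀ {A g h} → g ≗ h → Covered A g → Covered A h
  Covered-resp g≗h = Any.map λ covers y Qy → trans (covers y Qy) (cong just (g≗h y))

  module _ (φ : Form (Fin n)) where

    module Round (τ ρ : AnnVar n → Bool) where

      response : Assign n → Assign n
      response = unann Q ∃q τ

      counter : Assign n → Assign n
      counter α = unann Q ∀q ρ (response α)

      counter-values : Assign n → Fin n → Bool
      counter-values α y = ρ (annot (response α) y)

      counter-covers : ∀ α → Covers (counter α) (counter-values α)
      counter-covers α y Qy = unann-match {∀q} {ρ} {response α} Qy (unann-∃-at-∀ {τ} {α} Qy)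

      covers⇒≗counter : ∀ {γ α} → OnlyUniversal γ → Covers γ (counter-values α) → γ ≗ counter α
      covers⇒≗counter {γ} {α} univ covers y with ∀-or-∃ y
      ... | inj₁ Qy = trans (covers y Qy) (sym (counter-covers α y Qy))
      ... | inj₂ Qy = trans (univ y Qy) (sym (unann-∀-at-∃ {ρ} {response α} Qy))

      counter-agree : ∀ {k α β} → OnlyUniversal α → OnlyUniversal β →
                      AgreeBelow k α β → AgreeBelow (suc k) (counter α) (counter β)
      counter-agree {α = α} {β} univα univβ agree =
        unann-agree {∀q} {ρ} {σ = response α} {response β}
                    (unann-∃-agree {τ} {σ = α} {β} univα univβ agree)

      fill-fixpoint : ∀ {α} → OnlyUniversal α → α ≗ counter α → fill τ α ≗ fill ρ (response α)
      fill-fixpoint {α} univ fixed y with ∀-or-∃ y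
      ... | inj₁ Qy = begin
        fromMaybe (τ (annot α y)) (α y)
          ≡⟨ cong (fromMaybe _) (trans (fixed y) (counter-covers α y Qy)) ⟩
        counter-values α y
          ≡⟨ cong (fromMaybe _) (unann-∃-at-∀ {τ} {α} Qy) ⟨
        fromMaybe (counter-values α y) (response α y) ∎
        where open ≡-Reasoning
      ... | inj₂ Qy = begin
        fromMaybe (τ (annot α y)) (α y)
          ≡⟨ cong (fromMaybe _) (univ y Qy) ⟩
        τ (annot α y)
          ≡⟨ cong (fromMaybe _) (unann-match {∃q} {τ} {α} Qy (univ y Qy)) ⟨
        fromMaybe (counter-values α y) (response α y) ∎
        where open ≡-Reasoning

      Closed : List (Assign n) → Set
      Closed A = All (Covered A ∘ counter-values) A

      closed⇒counter-prefix : ∀ {A} → Closed A → All OnlyUniversal A → ∃[ α ] α ∈ A →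
                              ∀ k → ∃[ α ] α ∈ A × AgreeBelow k α (counter α)
      closed⇒counter-prefix closed univ (α₀ , α₀∈A) zero = α₀ , α₀∈A , λ y ()
      closed⇒counter-prefix closed univ nonempty (suc k)
        with closed⇒counter-prefix closed univ nonempty k
      ... | α , α∈A , α≈counter with find (All.lookup closed α∈A)
      ... | β , β∈A , covers =
        β , β∈A , λ y y≤k → trans (β≗ y) (counter-agree univα univβ α≈β y y≤k)
        where
        univα = All.lookup univ α∈A
        univβ = All.lookup univ β∈A
        β≗ : β ≗ counter α
        β≗ = covers⇒≗counter univβ covers
        α≈β : AgreeBelow k α β
        α≈β y y<k = trans (α≈counter y y<k) (sym (β≗ y))

      ¬closed : ∀ {A} → All (λ α → eval τ (inst α φ) ≡ true) A →
                All (λ α → eval ρ (neg (inst (response α) φ)) ≡ true) A →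
                All OnlyUniversal A → ∃[ α ] α ∈ A → ¬ Closed A
      ¬closed τ⊨ ρ⊭ univ nonempty closed with closed⇒counter-prefix closed univ nonempty n
      ... | α , α∈A , α≈counter = contradiction true≡false λ ()
        where
        open ≡-Reasoning
        fixed : α ≗ counter α
        fixed y = α≈counter y (toℕ<n y)
        true≡false : true ≡ false
        true≡false = begin
          true                          ≡⟨ All.lookup τ⊨ α∈A ⟨
          eval τ (inst α φ)             ≡⟨ eval-inst τ α φ ⟩
          eval (fill τ α) φ             ≡⟨ eval-cong (fill-fixpoint (All.lookup univ α∈A) fixed) φ ⟩
          eval (fill ρ (response α)) φ  ≡⟨ eval-inst ρ (response α) φ ⟨
          eval ρ (inst (response α) φ)  ≡⟨ not-injective (All.lookup ρ⊭ α∈A) ⟩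
          false                         ∎

    Invariant : List (Assign n) → Set
    Invariant A = All OnlyUniversal A × ∃[ α ] α ∈ A

    step-Invariant : ∀ {A S A′ S′} → Step Q φ (A , S) (A′ , S′) → Invariant A → Invariant A′
    step-Invariant (τ , _ , refl , ρ , _ , refl) (univ , α₀ , α₀∈A) =
      Allₚ.++⁺ univ (Allₚ.map⁺ (All.universal (λ σ → unann-∀-OnlyUniversal {ρ} {σ}) _)) ,
      α₀ , ∈-++⁺ˡ α₀∈A

    step-covers-new : ∀ {A S A′ S′} → Step Q φ (A , S) (A′ , S′) → Invariant A →
                      ∃[ g ] Covered A′ g × ¬ Covered A g
    step-covers-new {A} {S} (τ , τ⊨ , refl , ρ , ρ⊭ , refl) (univ , nonempty) =
      let α , α∈A , ¬covered = find (Allₚ.¬All⇒Any¬ (covered? A ∘ counter-values) A open-round)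
      in counter-values α , lose (counter∈ α∈A) (counter-covers α) , ¬covered
      where
      open Round τ ρ
      open-round : ¬ Closed A
      open-round = ¬closed τ⊨ (Allₚ.map⁻ (Allₚ.++⁻ʳ S ρ⊭)) univ nonempty
      counter∈ : ∀ {α} → α ∈ A → counter α ∈ A ++ map (unann Q ∀q ρ) (S ++ map response A)
      counter∈ α∈A = ∈-++⁺ʳ A (∈-map⁺ (unann Q ∀q ρ) (∈-++⁺ʳ S (∈-map⁺ response α∈A)))

    uncovered : List (Assign n) → ℕ
    uncovered A = length (filter (¬? ∘ covered? A) (valuations n))

    step-decreases-uncovered : ∀ {A S A′ S′} → Step Q φ (A , S) (A′ , S′) → Invariant A →
                               uncovered A′ < uncovered A
    step-decreases-uncovered {A} {A′ = A′} step@(_ , _ , refl , _ , _ , refl) inv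
      with step-covers-new step inv
    ... | g , covered′ , ¬covered =
      length-filter-< (¬? ∘ covered? A′) (¬? ∘ covered? A) (λ ¬covered′ → ¬covered′ ∘ Anyₚ.++⁺ˡ)
                      (Any.map newly-covered (valuations-complete g))
      where
      newly-covered : ∀ {h} → h ≗ g → ¬ Covered A h × ¬ ¬ Covered A′ h
      newly-covered h≗g = ¬covered ∘ Covered-resp h≗g ,
                          λ ¬covered′ → ¬covered′ (Covered-resp (sym ∘ h≗g) covered′)

    accessible : ∀ A S → Invariant A → Acc _<_ (uncovered A) → Acc (λ t s → Step Q φ s t) (A , S)
    accessible A S inv (acc smaller) =
      acc λ {(A′ , S′)} step →
        accessible A′ S′ (step-Invariant step inv) (smaller (step-decreases-uncovered step inv))

theorem2 : {n : ℕ} (Q : Fin n → Quant) (φ : Form (Fin n)) (f : Fin n → Bool) →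
    Acc (λ t s → Step Q φ s t) (initState Q f)
theorem2 Q φ f = accessible Q φ _ [] (α₀-univ ∷ [] , _ , here refl) (<-wellFounded _)
  where
  α₀-univ : OnlyUniversal Q (λ x → if ∀q =Q Q x then just (f x) else nothing)
  α₀-univ x Qx≡∃ rewrite Qx≡∃ = refl
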